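{- Let $F$ be a flat of a matroid $M$. The following are equivalent: (1) $F$ is a modular flat of $M$; (2) $F-G$ and $G-F$ are skew in $M/(F\cap G)$ for every flat $G$ of $M$; (3) $F$ and $G$ are skew in $M/\!\!/(F\cap G)$ for every flat $G$ of $M$; (4) every flat $G$ with $F\cap G\subseteq\mathrm{cl}_M(\varnothing)$ is skew to $F$; (5) every complementary flat of $F$ in $M$ is skew to $F$; (6) for every $C\subseteq E(M)$ and every nonloop $e$ of $M/C$ with $e\in\mathrm{cl}_{M/C}(F-C)$, there exists $f\in F$ that is parallel to $e$ in $M/C$; (7) for every pair of flats $F_0,G$ of $M$ with $F_0\subseteq F$, $F\cap\mathrm{cl}_M(G\cup F_0)=\mathrm{cl}_M((F\cap G)\cup F_0)$; (8) for every pair $G_1,G_2$ of flats of $M$ with $G_1\subseteq G_2$, $\mathrm{cl}_M(G_1\cup F)\cap G_2=\mathrm{cl}_M(G_1\cup(F\cap G_2))$.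
   Context: Matroids are possibly infinite (in the sense of Bruhn, Diestel, Kriesell, Pendavingh and Wollan). A pair $(X,Y)$ of sets is modular if some independent set $B$ has $B\cap X$ a basis for $X$ and $B\cap Y$ a basis for $Y$; a flat $F$ is modular if $(F,G)$ is a modular pair for every flat $G$. Sets $X,Y$ are skew in $M$ if $(X,Y)$ is a modular pair and $X\cap Y\subseteq\mathrm{cl}_M(\varnothing)$. $M/\!\!/Z=(M/Z)\oplus O_Z$ with $O_Z$ the rank-zero matroid on $Z$. Two flats $F,F'$ are complementary if $F\cup F'$ is spanning and $F\cap F'=\mathrm{cl}_M(\varnothing)$. -}

module Defs where

open import Level using (0ℓ) renaming (suc to lsuc)
open import Data.Empty using (⊥)
open import Data.Product using (Σ; ∃; ∃-syntax; _×_; _,_)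
open import Data.Sum using (_⊎_)
open import Relation.Nullary using (¬_; Dec)
open import Relation.Binary.PropositionalEquality using (_≡_)
open import Relation.Unary using (Pred; _⊆_; _≐_; _∩_; _∪_; _∖_; ∅; ｛_｝; _∈_)
open import Function.Bundles using (_⇔_)

Subset : Set → Set₁
Subset α = Pred α 0ℓ

-- All matroid notions (bases, closure, flats, ...) are defined at this level
-- so that they apply to minors such as M / C and M // Z.
record IndepSystem (α : Set) : Set₂ where
  field
    E     : Subset α
    Indep : Subset α → Set₁

module _ {α : Set} (N : IndepSystem α) where
  open IndepSystem N

  Basis : Subset α → Subset α → Set₁
  Basis X J = (J ⊆ X) × Indep J × (∀ K → Indep K → J ⊆ K → K ⊆ X → K ⊆ J)

  Base : Subset α → Set₁
  Base B = Indep B × (∀ K → Indep K → B ⊆ K → K ⊆ B)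

  cl : Subset α → Pred α (lsuc 0ℓ)
  cl X e = e ∈ E × (e ∈ X ⊎ (∃[ I ] (I ⊆ X × Indep I × ¬ Indep (I ∪ ｛ e ｝))))

  Flat : Subset α → Set₁
  Flat F = (F ⊆ E) × (cl F ⊆ F)

  Loop : α → Set₁
  Loop e = e ∈ cl ∅

  Nonloop : α → Set₁
  Nonloop e = e ∈ E × ¬ Loop e

  Parallel : α → α → Set₁
  Parallel e f = Nonloop e × Nonloop f × (cl ｛ e ｝ ≐ cl ｛ f ｝)

  Spanning : Subset α → Set₁
  Spanning X = (X ⊆ E) × (E ⊆ cl X)

  ModularPair : Subset α → Subset α → Set₁
  ModularPair X Y = ∃[ B ] (Indep B × Basis X (B ∩ X) × Basis Y (B ∩ Y))

  Skew : Subset α → Subset α → Set₁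
  Skew X Y = ModularPair X Y × (X ∩ Y ⊆ cl ∅)

  ModularFlat : Subset α → Set₁
  ModularFlat F = Flat F × (∀ G → Flat G → ModularPair F G)

  Complementary : Subset α → Subset α → Set₁
  Complementary F F' = Flat F × Flat F' × Spanning (F ∪ F') × (F ∩ F' ≐ cl ∅)

  contract : Subset α → IndepSystem α
  contract C = record
    { E     = E ∖ C
    ; Indep = λ I → (I ⊆ E ∖ C) × (∃[ J ] (Basis (C ∩ E) J × Indep (I ∪ J))) }

  -- N // Z = (N / Z) ⊕ O_Z : ground set E, independent sets those of N / Z.
  contractLoops : Subset α → IndepSystem α
  contractLoops Z = record
    { E     = E
    ; Indep = IndepSystem.Indep (contract Z) }

-- Matroids (possibly infinite), axioms of Bruhn–Diestel–Kriesell–Pendavingh–Wollan.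
record Matroid (α : Set) : Set₂ where
  field
    sys : IndepSystem α
  open IndepSystem sys public
  field
    indep-⊆E     : ∀ I → Indep I → I ⊆ E
    indep-empty  : Indep ∅
    indep-subset : ∀ I J → Indep J → I ⊆ J → Indep I
    indep-aug    : ∀ I B → Indep I → ¬ Base sys I → Base sys B →
                   ∃[ x ] (x ∈ B × ¬ (x ∈ I) × Indep (I ∪ ｛ x ｝))
    indep-max    : ∀ X → X ⊆ E → ∀ I → Indep I → I ⊆ X →
                   ∃[ J ] (I ⊆ J × Basis sys X J)

-- The classical metatheory of the paper (law of excluded middle).
ExcludedMiddle : Set₂
ExcludedMiddle = (P : Set₁) → Dec P

module _ {α : Set} (M : Matroid α) (F : Subset α) where
  open Matroid M using (sys; E)

  Cond1 Cond2 Cond3 Cond4 Cond5 Cond6 Cond7 Cond8 : Set₁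
  Cond1 = ModularFlat sys F
  Cond2 = ∀ G → Flat sys G → Skew (contract sys (F ∩ G)) (F ∖ G) (G ∖ F)
  Cond3 = ∀ G → Flat sys G → Skew (contractLoops sys (F ∩ G)) F G
  Cond4 = ∀ G → Flat sys G → F ∩ G ⊆ cl sys ∅ → Skew sys F G
  Cond5 = ∀ F' → Complementary sys F F' → Skew sys F F'
  Cond6 = ∀ C → C ⊆ E → ∀ e → Nonloop (contract sys C) e →
            e ∈ cl (contract sys C) (F ∖ C) →
            ∃[ f ] (f ∈ F × Parallel (contract sys C) e f)
  Cond7 = ∀ F₀ G → Flat sys F₀ → Flat sys G → F₀ ⊆ F →
            (F ∩ cl sys (G ∪ F₀)) ≐ cl sys ((F ∩ G) ∪ F₀)
  Cond8 = ∀ G₁ G₂ → Flat sys G₁ → Flat sys G₂ → G₁ ⊆ G₂ →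
            (cl sys (G₁ ∪ F) ∩ G₂) ≐ cl sys (G₁ ∪ (F ∩ G₂))

{-# OPTIONS --safe #-}
module Submission where

-- For flats F, G with bases J_Z ⊆ J_F, J_G of F ∩ G, F, G, the pair (F, G) is modular exactly
-- when J_F ∪ J_G is independent.  Modularity of F thus lets one compute closures inside the
-- independent set J_F ∪ J_G, giving (3), (6) and (7); conversely (5)–(8) all lead to (4), the
-- case F ∩ G ⊆ cl ∅, and (4) upgrades to (1) by replacing G with the flat spanned by J_G ∖ J_Z.
-- Contractions enter only through  e ∈ cl_{M/C} A  ⇔  e ∉ C and e ∈ cl_M (A ∪ C).

open import Defs
open import Level using (0ℓ; Lift; lift; lower) renaming (suc to lsuc)
open import Data.Empty using (⊥-elim)
open import Data.Product using (∃-syntax; _×_; _,_; proj₁; proj₂; map₂)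
open import Data.Sum using (_⊎_; inj₁; inj₂; [_,_]′)
open import Function using (id; _∘_)
open import Function.Bundles using (_⇔_; mk⇔; Equivalence)
open import Relation.Nullary using (¬_; Dec; yes; no)
open import Relation.Nullary.Decidable using (True; toWitness; fromWitness; decidable-stable; map′)
open import Relation.Binary.PropositionalEquality using (_≡_; refl)
open import Relation.Unary using (Pred; _⊆_; _≐_; _∩_; _∪_; _∖_; ∅; ｛_｝; _∈_; _∉_; _⊥_)
open import Relation.Unary.Properties using (⊆-trans)

module Classical (em : ExcludedMiddle) where

  dec : (P : Set) → Dec P
  dec P = map′ lower lift (em (Lift _ P))

  by-contradiction : {P : Set₁} → ¬ ¬ P → P
  by-contradiction = decidable-stable (em _)

  -- Closures are predicates in Set₁; excluded middle shrinks them back to subsets.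
  resize : {β : Set} → Pred β (lsuc 0ℓ) → Subset β
  resize P x = True (em (P x))

  resize⁺ : {β : Set} {P : Pred β (lsuc 0ℓ)} {x : β} → P x → x ∈ resize P
  resize⁺ {P = P} {x} = fromWitness {a? = em (P x)}

  resize⁻ : {β : Set} {P : Pred β (lsuc 0ℓ)} {x : β} → x ∈ resize P → P x
  resize⁻ {P = P} {x} = toWitness {a? = em (P x)}

module MatroidTheory (em : ExcludedMiddle) {α : Set} (M : Matroid α) where
  open Classical em
  open Matroid M

  private variable
    A B C I J K X Y Z : Subset α
    e f x y : α

  infixl 6 _+_
  _+_ : Subset α → α → Subset α
  X + e = X ∪ ｛ e ｝

  +-⊆ : A ⊆ C → e ∈ C → A + e ⊆ C
  +-⊆ A⊆C e∈C (inj₁ a) = A⊆C a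
  +-⊆ A⊆C e∈C (inj₂ refl) = e∈C

  +-mono : A ⊆ B → A + e ⊆ B + e
  +-mono A⊆B = [ (λ a → inj₁ (A⊆B a)) , inj₂ ]′

  +-∪-⊆ : (A + e) ∪ B ⊆ (A ∪ B) + e
  +-∪-⊆ (inj₁ (inj₁ a)) = inj₁ (inj₁ a)
  +-∪-⊆ (inj₁ (inj₂ refl)) = inj₂ refl
  +-∪-⊆ (inj₂ b) = inj₁ (inj₂ b)

  indep-⊆ : Indep J → I ⊆ J → Indep I
  indep-⊆ iJ I⊆J = indep-subset _ _ iJ I⊆J

  cl-⊆E : cl sys X ⊆ E
  cl-⊆E = proj₁

  ⊆-cl : X ⊆ E → X ⊆ cl sys X
  ⊆-cl X⊆E x = X⊆E x , inj₁ x

  cl-mono : X ⊆ Y → cl sys X ⊆ cl sys Y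
  cl-mono X⊆Y (e∈E , inj₁ e∈X) = e∈E , inj₁ (X⊆Y e∈X)
  cl-mono X⊆Y (e∈E , inj₂ (I , I⊆X , iI , ¬iIe)) = e∈E , inj₂ (I , (λ i → X⊆Y (I⊆X i)) , iI , ¬iIe)

  indep⇒∉cl : Indep (A + e) → e ∉ A → ¬ cl sys A e
  indep⇒∉cl iAe e∉A (_ , inj₁ e∈A) = e∉A e∈A
  indep⇒∉cl iAe e∉A (_ , inj₂ (I , I⊆A , _ , ¬iIe)) = ¬iIe (indep-⊆ iAe (+-mono {A = I} I⊆A))

  ∉cl⇒indep : Indep A → e ∈ E → ¬ cl sys A e → Indep (A + e)
  ∉cl⇒indep iA e∈E e∉clA = by-contradiction λ ¬iAe → e∉clA (e∈E , inj₂ (_ , id , iA , ¬iAe))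

  basis-extend : X ⊆ E → Indep I → I ⊆ X → ∃[ J ] (I ⊆ J × Basis sys X J)
  basis-extend X⊆E iI I⊆X = indep-max _ X⊆E _ iI I⊆X

  basis-exists : X ⊆ E → ∃[ J ] Basis sys X J
  basis-exists X⊆E with basis-extend X⊆E indep-empty (λ ())
  ... | J , _ , bJ = J , bJ

  basis-maximal : Basis sys X J → x ∈ X → Indep (J + x) → x ∈ J
  basis-maximal (J⊆X , _ , maximal) x∈X iJx = maximal _ iJx inj₁ (+-⊆ J⊆X x∈X) (inj₂ refl)

  basis⇒⊆cl : X ⊆ E → Basis sys X J → X ⊆ cl sys J
  basis⇒⊆cl {J = J} X⊆E bJ {x} x∈X with dec (x ∈ J)
  ... | yes x∈J = X⊆E x∈X , inj₁ x∈J
  ... | no x∉J = X⊆E x∈X , inj₂ (_ , id , proj₁ (proj₂ bJ) , λ iJx → x∉J (basis-maximal bJ x∈X iJx))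

  basis-intro : J ⊆ X → Indep J → X ⊆ cl sys J → Basis sys X J
  basis-intro {J = J} {X = X} J⊆X iJ X⊆clJ = J⊆X , iJ , maximal
    where
    maximal : ∀ K → Indep K → J ⊆ K → K ⊆ X → K ⊆ J
    maximal K iK J⊆K K⊆X {k} k∈K with dec (k ∈ J)
    ... | yes k∈J = k∈J
    ... | no k∉J = ⊥-elim (indep⇒∉cl (indep-⊆ iK (+-⊆ J⊆K k∈K)) k∉J (X⊆clJ (K⊆X k∈K)))

  basis-cong : X ≐ Y → Basis sys X J → Basis sys Y J
  basis-cong (X⊆Y , Y⊆X) (J⊆X , iJ , maximal) =
    (λ j → X⊆Y (J⊆X j)) , iJ , λ K iK J⊆K K⊆Y → maximal K iK J⊆K (λ k → Y⊆X (K⊆Y k))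

  Base-of-basis-E : Basis sys E B → Base sys B
  Base-of-basis-E (_ , iB , maximal) = iB , λ K iK B⊆K → maximal K iK B⊆K (indep-⊆E K iK)

  Base-of-unaugmentable : Indep I → Base sys B → (∀ {x} → x ∈ B → x ∉ I → ¬ Indep (I + x)) → Base sys I
  Base-of-unaugmentable iI bB unaug = by-contradiction λ ¬bI →
    let x , x∈B , x∉I , iIx = indep-aug _ _ iI ¬bI bB in unaug x∈B x∉I iIx

  -- With B ⊇ J a base and K ⊇ I + y a basis of (I + y) ∪ B, the set J ∪ (K ∖ (I + y)) is a
  -- base, and it can only augment the non-base I ∪ (K ∖ (I + y)) through some x ∈ J augmenting I.
  basis-augment : X ⊆ E → Basis sys X J → Indep I → I ⊆ X → y ∈ X → y ∉ I → Indep (I + y) →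
                  ∃[ x ] (x ∈ J × x ∉ I × Indep (I + x))
  basis-augment {X = X} {J = J} {I = I} {y = y} X⊆E bJ@(J⊆X , iJ , _) iI I⊆X y∈X y∉I iIy
    with basis-extend {X = E} id iJ (indep-⊆E J iJ)
  ... | B , J⊆B , bB@(_ , iB , _)
    with basis-extend {X = (I + y) ∪ B} [ +-⊆ {A = I} (⊆-trans {j = X} I⊆X X⊆E) (X⊆E y∈X) , indep-⊆E B iB ]′
                      iIy inj₁
  ... | K , I+y⊆K , bK@(_ , iK , _) =
    by-contradiction λ ¬aug → I∪D-not-Base (Base-of-unaugmentable iI∪D J∪D-Base λ where
      (inj₁ x∈J) x∉I∪D iI∪Dx →
        ¬aug (_ , x∈J , (λ x∈I → x∉I∪D (inj₁ x∈I)) , indep-⊆ iI∪Dx (+-mono {A = I} {B = I ∪ D} inj₁))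
      (inj₂ x∈D) x∉I∪D _ → x∉I∪D (inj₂ x∈D))
    where
    D : Subset α
    D x = x ∈ K × x ∉ I + y

    D⊆B : D ⊆ B
    D⊆B (x∈K , x∉I+y) with proj₁ bK x∈K
    ... | inj₁ x∈I+y = ⊥-elim (x∉I+y x∈I+y)
    ... | inj₂ x∈B = x∈B

    K-Base : Base sys K
    K-Base = Base-of-unaugmentable iK (Base-of-basis-E bB) λ x∈B x∉K iKx →
      x∉K (basis-maximal bK (inj₂ x∈B) iKx)

    I∪D⊆K : I ∪ D ⊆ K
    I∪D⊆K (inj₁ i) = I+y⊆K (inj₁ i)
    I∪D⊆K (inj₂ (k , _)) = k

    iI∪D : Indep (I ∪ D)
    iI∪D = indep-⊆ iK I∪D⊆K

    I∪D-not-Base : ¬ Base sys (I ∪ D)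
    I∪D-not-Base (_ , maximal)
      with maximal ((I ∪ D) + y) (indep-⊆ iK (+-⊆ I∪D⊆K (I+y⊆K (inj₂ refl)))) inj₁ (inj₂ refl)
    ... | inj₁ y∈I = y∉I y∈I
    ... | inj₂ (_ , y∉I+y) = y∉I+y (inj₂ refl)

    J∪D-Base : Base sys (J ∪ D)
    J∪D-Base = Base-of-unaugmentable (indep-⊆ iB [ J⊆B , D⊆B ]′) K-Base λ x∈K x∉J∪D iJ∪Dx →
      x∉J∪D (inj₁ (basis-maximal bJ (x∈X x∈K x∉J∪D) (indep-⊆ iJ∪Dx (+-mono {A = J} {B = J ∪ D} inj₁))))
      where
      x∈X : ∀ {x} → x ∈ K → x ∉ J ∪ D → x ∈ X
      x∈X {x} x∈K x∉J∪D with dec (x ∈ I + y)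
      ... | yes (inj₁ x∈I) = I⊆X x∈I
      ... | yes (inj₂ refl) = y∈X
      ... | no x∉I+y = ⊥-elim (x∉J∪D (inj₂ (x∈K , x∉I+y)))

  cl-⊆-cl-basis : X ⊆ E → Basis sys X J → cl sys X ⊆ cl sys J
  cl-⊆-cl-basis X⊆E bJ (_ , inj₁ e∈X) = basis⇒⊆cl X⊆E bJ e∈X
  cl-⊆-cl-basis {X = X} {J = J} X⊆E bJ@(J⊆X , iJ , _) {e} (e∈E , inj₂ (I , I⊆X , iI , ¬iIe)) with dec (e ∈ X)
  ... | yes e∈X = basis⇒⊆cl X⊆E bJ e∈X
  ... | no e∉X with basis-extend {X = X + e} (+-⊆ X⊆E e∈E) iI (λ i → inj₁ (I⊆X i))
  ...   | L , I⊆L , bL@(L⊆X+e , iL , _) = by-contradiction λ e∉clJ →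
    no-augmentation (basis-augment (+-⊆ X⊆E e∈E) bL iJ (λ j → inj₁ (J⊆X j)) (inj₂ refl)
                                   (λ e∈J → e∉X (J⊆X e∈J)) (∉cl⇒indep iJ e∈E e∉clJ))
    where
    no-augmentation : ¬ (∃[ x ] (x ∈ L × x ∉ J × Indep (J + x)))
    no-augmentation (x , x∈L , x∉J , iJx) with L⊆X+e x∈L
    ... | inj₁ x∈X = x∉J (basis-maximal bJ x∈X iJx)
    ... | inj₂ refl = ¬iIe (indep-⊆ iL (+-⊆ I⊆L x∈L))

  cl-⊆-cl : X ⊆ E → Y ⊆ cl sys X → cl sys Y ⊆ cl sys X
  cl-⊆-cl {X = X} {Y = Y} X⊆E Y⊆clX c with basis-exists X⊆E
  ... | J , bJ@(J⊆X , iJ , _) = cl-mono J⊆X (cl-⊆-cl-basis Y∪J⊆E bJ' (cl-mono {Y = Y ∪ J} inj₁ c))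
    where
    Y∪J⊆E : Y ∪ J ⊆ E
    Y∪J⊆E (inj₁ y) = cl-⊆E (Y⊆clX y)
    Y∪J⊆E (inj₂ j) = indep-⊆E J iJ j

    bJ' : Basis sys (Y ∪ J) J
    bJ' = basis-intro inj₂ iJ Y∪J⊆clJ
      where
      Y∪J⊆clJ : Y ∪ J ⊆ cl sys J
      Y∪J⊆clJ (inj₁ y) = cl-⊆-cl-basis X⊆E bJ (Y⊆clX y)
      Y∪J⊆clJ (inj₂ j) = ⊆-cl (indep-⊆E J iJ) j

  -- Extend K to a basis L of I ∪ K.  L spans W = J ∪ (I ∩ L); an element of I ∖ L would then
  -- lie in cl W although adding it to W gives a subset of the independent set I ∪ J.
  indep-∪-swap : Indep (I ∪ J) → I ⊥ J → Indep K → K ⊆ cl sys J → Indep (I ∪ K)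
  indep-∪-swap {I = I} {J = J} {K = K} iI∪J I⊥J iK K⊆clJ = from-basis (basis-extend I∪K⊆E iK inj₂)
    where
    I∪J⊆E : I ∪ J ⊆ E
    I∪J⊆E = indep-⊆E _ iI∪J

    I∪K⊆E : I ∪ K ⊆ E
    I∪K⊆E (inj₁ i) = I∪J⊆E (inj₁ i)
    I∪K⊆E (inj₂ k) = indep-⊆E K iK k

    from-basis : ∃[ L ] (K ⊆ L × Basis sys (I ∪ K) L) → Indep (I ∪ K)
    from-basis (L , K⊆L , bL@(L⊆I∪K , iL , _)) = indep-⊆ iL [ I⊆L , K⊆L ]′
      where
      W : Subset α
      W x = x ∈ J ⊎ (x ∈ I × x ∈ L)

      W⊆E : W ⊆ E
      W⊆E (inj₁ j) = I∪J⊆E (inj₂ j)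
      W⊆E (inj₂ (i , _)) = I∪J⊆E (inj₁ i)

      L⊆clW : L ⊆ cl sys W
      L⊆clW l with L⊆I∪K l
      ... | inj₁ i = ⊆-cl W⊆E (inj₂ (i , l))
      ... | inj₂ k = cl-mono {Y = W} inj₁ (K⊆clJ k)

      W+i⊆I∪J : ∀ {i} → i ∈ I → W + i ⊆ I ∪ J
      W+i⊆I∪J _ (inj₁ (inj₁ j)) = inj₂ j
      W+i⊆I∪J _ (inj₁ (inj₂ (i , _))) = inj₁ i
      W+i⊆I∪J i∈I (inj₂ refl) = inj₁ i∈I

      I⊆L : I ⊆ L
      I⊆L {i} i∈I with dec (i ∈ L)
      ... | yes i∈L = i∈L
      ... | no i∉L = ⊥-elim (indep⇒∉cl (indep-⊆ iI∪J (W+i⊆I∪J i∈I)) i∉W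
                               (cl-⊆-cl W⊆E L⊆clW (basis⇒⊆cl I∪K⊆E bL (inj₁ i∈I))))
        where
        i∉W : i ∉ W
        i∉W (inj₁ i∈J) = I⊥J (i∈I , i∈J)
        i∉W (inj₂ (_ , i∈L)) = i∉L i∈L

  -- If z ∉ J, exchange I for (I ∩ J) + z ⊆ cl I inside the independent (J ∖ I) ∪ I.
  cl-∩ : Indep B → I ⊆ B → J ⊆ B → cl sys I ∩ cl sys J ⊆ cl sys (I ∩ J)
  cl-∩ {B = B} {I = I} {J = J} iB I⊆B J⊆B {z} (z∈clI , z∈clJ) = by-contradiction ¬¬z∈cl
    where
    B⊆E : B ⊆ E
    B⊆E = indep-⊆E B iB

    ¬¬z∈cl : ¬ ¬ cl sys (I ∩ J) z
    ¬¬z∈cl z∉cl with dec (z ∈ J) | dec (z ∈ I)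
    ... | yes z∈J | yes z∈I = z∉cl (⊆-cl (λ (i , _) → B⊆E (I⊆B i)) (z∈I , z∈J))
    ... | yes z∈J | no z∉I = indep⇒∉cl (indep-⊆ iB (+-⊆ I⊆B (J⊆B z∈J))) z∉I z∈clI
    ... | no z∉J | _ = indep⇒∉cl (indep-⊆ iSwapped J+z⊆Swapped) z∉J z∈clJ
      where
      J∖I∪I⊆B : (J ∖ I) ∪ I ⊆ B
      J∖I∪I⊆B (inj₁ (j , _)) = J⊆B j
      J∖I∪I⊆B (inj₂ i) = I⊆B i

      I∩J+z⊆clI : (I ∩ J) + z ⊆ cl sys I
      I∩J+z⊆clI (inj₁ (i , _)) = ⊆-cl (⊆-trans {j = B} I⊆B B⊆E) i
      I∩J+z⊆clI (inj₂ refl) = z∈clI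

      iSwapped : Indep ((J ∖ I) ∪ ((I ∩ J) + z))
      iSwapped = indep-∪-swap (indep-⊆ iB J∖I∪I⊆B) (λ ((_ , j∉I) , j∈I) → j∉I j∈I)
                   (∉cl⇒indep (indep-⊆ iB (λ (i , _) → I⊆B i)) (cl-⊆E z∈clI) z∉cl) I∩J+z⊆clI

      J+z⊆Swapped : J + z ⊆ (J ∖ I) ∪ ((I ∩ J) + z)
      J+z⊆Swapped (inj₂ refl) = inj₂ (inj₂ refl)
      J+z⊆Swapped {x} (inj₁ x∈J) with dec (x ∈ I)
      ... | yes x∈I = inj₂ (inj₁ (x∈I , x∈J))
      ... | no x∉I = inj₁ (x∈J , x∉I)

  exchange : C ⊆ E → e ∈ E → cl sys (C + e) f → ¬ cl sys C f → cl sys (C + f) e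
  exchange {C = C} {e = e} {f = f} C⊆E e∈E f∈cl f∉clC = by-contradiction ¬¬e∈cl
    where
    ¬¬e∈cl : ¬ ¬ cl sys (C + f) e
    ¬¬e∈cl e∉cl with dec (e ≡ f) | basis-exists C⊆E
    ... | yes refl | _ = e∉cl (e∈E , inj₁ (inj₂ refl))
    ... | no e≢f | J , bJ@(J⊆C , iJ , _) = indep⇒∉cl iJ+e+f f∉J+e f∈clJ+e
      where
      J+e⊆E : J + e ⊆ E
      J+e⊆E = +-⊆ (indep-⊆E J iJ) e∈E

      iJ+f+e : Indep ((J + f) + e)
      iJ+f+e = ∉cl⇒indep (∉cl⇒indep iJ (cl-⊆E f∈cl) (λ c → f∉clC (cl-mono J⊆C c))) e∈E
                          (λ c → e∉cl (cl-mono (+-mono {A = J} J⊆C) c))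

      iJ+e+f : Indep ((J + e) + f)
      iJ+e+f = indep-⊆ iJ+f+e λ where
        (inj₁ (inj₁ j)) → inj₁ (inj₁ j)
        (inj₁ (inj₂ refl)) → inj₂ refl
        (inj₂ refl) → inj₁ (inj₂ refl)

      C+e⊆clJ+e : C + e ⊆ cl sys (J + e)
      C+e⊆clJ+e (inj₁ c) = cl-mono {Y = J + e} inj₁ (basis⇒⊆cl C⊆E bJ c)
      C+e⊆clJ+e (inj₂ refl) = ⊆-cl J+e⊆E (inj₂ refl)

      f∈clJ+e : cl sys (J + e) f
      f∈clJ+e = cl-⊆-cl J+e⊆E C+e⊆clJ+e f∈cl

      f∉J+e : f ∉ J + e
      f∉J+e (inj₁ f∈J) = f∉clC (⊆-cl C⊆E (J⊆C f∈J))
      f∉J+e (inj₂ refl) = e≢f refl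

  dependent-∪ : I ∪ J ⊆ E → Indep I → ¬ Indep (I ∪ J) →
                ∃[ x ] ∃[ K ] (x ∈ J × K ⊆ J × x ∉ K × cl sys (I ∪ K) x)
  dependent-∪ {I = I} {J = J} I∪J⊆E iI dep with basis-extend I∪J⊆E iI inj₁
  ... | L , I⊆L , bL@(L⊆I∪J , iL , _) = by-contradiction λ none →
    dep (indep-⊆ iL [ I⊆L , J⊆L none ]′)
    where
    L⊆I∪L∩J : L ⊆ I ∪ (L ∩ J)
    L⊆I∪L∩J l with L⊆I∪J l
    ... | inj₁ i = inj₁ i
    ... | inj₂ j = inj₂ (l , j)

    J⊆L : ¬ (∃[ x ] ∃[ K ] (x ∈ J × K ⊆ J × x ∉ K × cl sys (I ∪ K) x)) → J ⊆ L
    J⊆L none {x} x∈J with dec (x ∈ L)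
    ... | yes x∈L = x∈L
    ... | no x∉L = ⊥-elim (none (x , L ∩ J , x∈J , proj₂ , (λ (x∈L , _) → x∉L x∈L) ,
                                 cl-mono L⊆I∪L∩J (basis⇒⊆cl I∪J⊆E bL (inj₂ x∈J))))

  modularPair-intro : Indep (I ∪ J) → I ⊆ X → J ⊆ Y → X ⊆ cl sys I → Y ⊆ cl sys J → ModularPair sys X Y
  modularPair-intro {I = I} {J = J} {X = X} {Y = Y} iI∪J I⊆X J⊆Y X⊆clI Y⊆clJ =
    I ∪ J , iI∪J , basis-intro proj₂ (indep-⊆ iI∪J proj₁) (λ x → cl-mono I⊆I∪J∩X (X⊆clI x))
                 , basis-intro proj₂ (indep-⊆ iI∪J proj₁) (λ y → cl-mono J⊆I∪J∩Y (Y⊆clJ y))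
    where
    I⊆I∪J∩X : I ⊆ (I ∪ J) ∩ X
    I⊆I∪J∩X i = inj₁ i , I⊆X i

    J⊆I∪J∩Y : J ⊆ (I ∪ J) ∩ Y
    J⊆I∪J∩Y j = inj₂ j , J⊆Y j

  modularPair-of-bases : X ⊆ E → Y ⊆ E → Basis sys X I → Basis sys Y J → Indep (I ∪ J) → ModularPair sys X Y
  modularPair-of-bases X⊆E Y⊆E bI bJ iI∪J =
    modularPair-intro iI∪J (proj₁ bI) (proj₁ bJ) (basis⇒⊆cl X⊆E bI) (basis⇒⊆cl Y⊆E bJ)

  -- With B the witness of modularity, exchange B ∩ X for I, then (B ∩ Y) ∖ X together with
  -- the common part K for J.
  modularPair⇒indep-∪ : X ⊆ E → Y ⊆ E → ModularPair sys X Y → Basis sys (X ∩ Y) K →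
                        Basis sys X I → K ⊆ I → Basis sys Y J → K ⊆ J → Indep (I ∪ J)
  modularPair⇒indep-∪ {X = X} {Y = Y} {K = K} {I = I} {J = J}
                      X⊆E Y⊆E (B , iB , bB∩X , bB∩Y) bK@(K⊆X∩Y , _) bI@(I⊆X , iI , _) K⊆I bJ K⊆J =
    indep-⊆ iI∖K∪J I∪J⊆I∖K∪J
    where
    Q : Subset α
    Q x = x ∈ B × x ∈ Y × x ∉ X

    iQ∪I : Indep (Q ∪ I)
    iQ∪I = indep-∪-swap (indep-⊆ iB Q∪B∩X⊆B) (λ ((_ , _ , x∉X) , (_ , x∈X)) → x∉X x∈X) iI I⊆clB∩X
      where
      Q∪B∩X⊆B : Q ∪ (B ∩ X) ⊆ B
      Q∪B∩X⊆B (inj₁ (b , _)) = b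
      Q∪B∩X⊆B (inj₂ (b , _)) = b

      I⊆clB∩X : I ⊆ cl sys (B ∩ X)
      I⊆clB∩X i = basis⇒⊆cl X⊆E bB∩X (I⊆X i)

    K∪Q⊆E : K ∪ Q ⊆ E
    K∪Q⊆E (inj₁ k) = X⊆E (proj₁ (K⊆X∩Y k))
    K∪Q⊆E (inj₂ (b , _)) = indep-⊆E B iB b

    I∖K∪K∪Q⊆Q∪I : (I ∖ K) ∪ (K ∪ Q) ⊆ Q ∪ I
    I∖K∪K∪Q⊆Q∪I (inj₁ (i , _)) = inj₂ i
    I∖K∪K∪Q⊆Q∪I (inj₂ (inj₁ k)) = inj₂ (K⊆I k)
    I∖K∪K∪Q⊆Q∪I (inj₂ (inj₂ q)) = inj₁ q

    I∖K⊥K∪Q : (I ∖ K) ⊥ (K ∪ Q)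
    I∖K⊥K∪Q ((_ , x∉K) , inj₁ x∈K) = x∉K x∈K
    I∖K⊥K∪Q ((x∈I , _) , inj₂ (_ , _ , x∉X)) = x∉X (I⊆X x∈I)

    B∩Y⊆clK∪Q : B ∩ Y ⊆ cl sys (K ∪ Q)
    B∩Y⊆clK∪Q {b} (b∈B , b∈Y) with dec (b ∈ X)
    ... | yes b∈X = cl-mono {Y = K ∪ Q} inj₁ (basis⇒⊆cl (λ (x , _) → X⊆E x) bK (b∈X , b∈Y))
    ... | no b∉X = ⊆-cl K∪Q⊆E (inj₂ (b∈B , b∈Y , b∉X))

    J⊆clK∪Q : J ⊆ cl sys (K ∪ Q)
    J⊆clK∪Q j = cl-⊆-cl K∪Q⊆E B∩Y⊆clK∪Q (basis⇒⊆cl Y⊆E bB∩Y (proj₁ bJ j))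

    iI∖K∪J : Indep ((I ∖ K) ∪ J)
    iI∖K∪J = indep-∪-swap (indep-⊆ iQ∪I I∖K∪K∪Q⊆Q∪I) I∖K⊥K∪Q (proj₁ (proj₂ bJ)) J⊆clK∪Q

    I∪J⊆I∖K∪J : I ∪ J ⊆ (I ∖ K) ∪ J
    I∪J⊆I∖K∪J {x} (inj₁ x∈I) with dec (x ∈ K)
    ... | yes x∈K = inj₂ (K⊆J x∈K)
    ... | no x∉K = inj₁ (x∈I , x∉K)
    I∪J⊆I∖K∪J (inj₂ x∈J) = inj₂ x∈J

  skew⇒indep-∪ : X ⊆ E → Y ⊆ E → Skew sys X Y → Indep I → I ⊆ X → Indep J → J ⊆ Y → Indep (I ∪ J)
  skew⇒indep-∪ {X = X} {Y = Y} {I = I} {J = J} X⊆E Y⊆E (mp , X∩Y⊆loops) iI I⊆X iJ J⊆Y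
    with basis-extend X⊆E iI I⊆X | basis-extend Y⊆E iJ J⊆Y
  ... | I' , I⊆I' , bI' | J' , J⊆J' , bJ' =
    indep-⊆ (modularPair⇒indep-∪ X⊆E Y⊆E mp ∅-basis bI' (λ ()) bJ' (λ ()))
            I∪J⊆I'∪J'
    where
    I∪J⊆I'∪J' : I ∪ J ⊆ I' ∪ J'
    I∪J⊆I'∪J' (inj₁ i) = inj₁ (I⊆I' i)
    I∪J⊆I'∪J' (inj₂ j) = inj₂ (J⊆J' j)

    ∅-basis : Basis sys (X ∩ Y) ∅
    ∅-basis = basis-intro (λ ()) indep-empty X∩Y⊆loops

  flat-cl : Flat sys C → X ⊆ C → cl sys X ⊆ C
  flat-cl (_ , clC⊆C) X⊆C x = clC⊆C (cl-mono X⊆C x)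

  loops⊆flat : Flat sys C → cl sys ∅ ⊆ C
  loops⊆flat flat-C = flat-cl flat-C (λ ())

  ⟨_⟩ : Subset α → Subset α
  ⟨ X ⟩ = resize (cl sys X)

  ⟨⟩⁺ : cl sys X x → x ∈ ⟨ X ⟩
  ⟨⟩⁺ {X = X} = resize⁺ {P = cl sys X}

  ⟨⟩⁻ : x ∈ ⟨ X ⟩ → cl sys X x
  ⟨⟩⁻ {X = X} = resize⁻ {P = cl sys X}

  ⟨⟩-flat : X ⊆ E → Flat sys ⟨ X ⟩
  ⟨⟩-flat {X = X} X⊆E = ⟨X⟩⊆E , cl⟨X⟩⊆⟨X⟩
    where
    ⟨X⟩⊆E : ⟨ X ⟩ ⊆ E
    ⟨X⟩⊆E x = cl-⊆E (⟨⟩⁻ x)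

    ⟨X⟩⊆clX : ⟨ X ⟩ ⊆ cl sys X
    ⟨X⟩⊆clX = ⟨⟩⁻

    cl⟨X⟩⊆⟨X⟩ : cl sys ⟨ X ⟩ ⊆ ⟨ X ⟩
    cl⟨X⟩⊆⟨X⟩ x = ⟨⟩⁺ (cl-⊆-cl X⊆E ⟨X⟩⊆clX x)

  Indep/ : Subset α → Subset α → Set₁
  Indep/ Z = IndepSystem.Indep (contract sys Z)

  contract-indep-⊆ : Indep/ Z J → I ⊆ J → Indep/ Z I
  contract-indep-⊆ (J⊆E∖Z , K , bK , iJ∪K) I⊆J =
    (λ i → J⊆E∖Z (I⊆J i)) , K , bK , indep-⊆ iJ∪K λ where
      (inj₁ i) → inj₁ (I⊆J i)
      (inj₂ k) → inj₂ k

  contract-indep-swap : Indep/ Z I → Basis sys (Z ∩ E) J → Indep (I ∪ J)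
  contract-indep-swap {J = J} (I⊆E∖Z , K , bK@(K⊆Z∩E , _) , iI∪K) (J⊆Z∩E , iJ , _) =
    indep-∪-swap iI∪K (λ (i , k) → proj₂ (I⊆E∖Z i) (proj₁ (K⊆Z∩E k))) iJ J⊆clK
    where
    J⊆clK : J ⊆ cl sys K
    J⊆clK j = basis⇒⊆cl proj₂ bK (J⊆Z∩E j)

  cl-contract⇒cl : cl (contract sys C) A e → cl sys (A ∪ C) e
  cl-contract⇒cl ((e∈E , _) , inj₁ e∈A) = e∈E , inj₁ (inj₁ e∈A)
  cl-contract⇒cl {C = C} {A = A} {e = e}
                 ((e∈E , e∉C) , inj₂ (I , I⊆A , (I⊆E∖C , J , bJ@(J⊆C∩E , _) , iI∪J) , ¬iI+e)) =
    e∈E , inj₂ (I ∪ J , I∪J⊆A∪C , iI∪J ,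
                λ iI∪J+e → ¬iI+e (I+e⊆E∖C , J , bJ , indep-⊆ iI∪J+e (+-∪-⊆ {A = I} {B = J})))
    where
    I∪J⊆A∪C : I ∪ J ⊆ A ∪ C
    I∪J⊆A∪C (inj₁ i) = inj₁ (I⊆A i)
    I∪J⊆A∪C (inj₂ j) = inj₂ (proj₁ (J⊆C∩E j))

    I+e⊆E∖C : I + e ⊆ E ∖ C
    I+e⊆E∖C (inj₁ i) = I⊆E∖C i
    I+e⊆E∖C (inj₂ refl) = e∈E , e∉C

  -- Extend a basis J of C to a basis L of A ∪ C; then L ∖ C ⊆ A witnesses e ∈ cl_{M/C} A.
  cl⇒cl-contract : A ⊆ E → C ⊆ E → e ∉ C → cl sys (A ∪ C) e → cl (contract sys C) A e
  cl⇒cl-contract {A = A} {C = C} {e = e} A⊆E C⊆E e∉C e∈cl with dec (e ∈ A) | basis-exists {X = C ∩ E} proj₂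
  ... | yes e∈A | _ = (cl-⊆E e∈cl , e∉C) , inj₁ e∈A
  ... | no e∉A | J , bJ@(J⊆C∩E , iJ , _)
    with basis-extend {X = A ∪ C} [ A⊆E , C⊆E ]′ iJ (λ j → inj₂ (proj₁ (J⊆C∩E j)))
  ...   | L , J⊆L , bL@(_ , iL , _) =
    (cl-⊆E e∈cl , e∉C) , inj₂ (L ∖ C , L∖C⊆A , contract-indep-L∖C , ¬contract-indep-L∖C+e)
    where
    A∪C⊆E : A ∪ C ⊆ E
    A∪C⊆E = [ A⊆E , C⊆E ]′

    L∖C⊆A : L ∖ C ⊆ A
    L∖C⊆A (k∈L , k∉C) with proj₁ bL k∈L
    ... | inj₁ k∈A = k∈A
    ... | inj₂ k∈C = ⊥-elim (k∉C k∈C)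

    contract-indep-L∖C : Indep/ C (L ∖ C)
    contract-indep-L∖C = (λ (k∈L , k∉C) → A∪C⊆E (proj₁ bL k∈L) , k∉C) , J , bJ , indep-⊆ iL L∖C∪J⊆L
      where
      L∖C∪J⊆L : (L ∖ C) ∪ J ⊆ L
      L∖C∪J⊆L (inj₁ (k , _)) = k
      L∖C∪J⊆L (inj₂ j) = J⊆L j

    L+e⊆L∖C+e∪J : L + e ⊆ ((L ∖ C) + e) ∪ J
    L+e⊆L∖C+e∪J (inj₂ refl) = inj₁ (inj₂ refl)
    L+e⊆L∖C+e∪J {k} (inj₁ k∈L) with dec (k ∈ C)
    ... | yes k∈C = inj₂ (basis-maximal bJ (k∈C , A∪C⊆E (proj₁ bL k∈L)) (indep-⊆ iL (+-⊆ J⊆L k∈L)))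
    ... | no k∉C = inj₁ (inj₁ (k∈L , k∉C))

    e∉L : e ∉ L
    e∉L e∈L with proj₁ bL e∈L
    ... | inj₁ e∈A = e∉A e∈A
    ... | inj₂ e∈C = e∉C e∈C

    ¬contract-indep-L∖C+e : ¬ Indep/ C ((L ∖ C) + e)
    ¬contract-indep-L∖C+e iL∖C+e =
      indep⇒∉cl (indep-⊆ (contract-indep-swap iL∖C+e bJ) L+e⊆L∖C+e∪J) e∉L (cl-⊆-cl-basis A∪C⊆E bL e∈cl)

  nonloop-contract : C ⊆ E → e ∈ E → ¬ cl sys C e → Nonloop (contract sys C) e
  nonloop-contract {C = C} C⊆E e∈E e∉clC =
    (e∈E , λ e∈C → e∉clC (⊆-cl C⊆E e∈C)) , λ loop → e∉clC (cl-mono ∅∪C⊆C (cl-contract⇒cl loop))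
    where
    ∅∪C⊆C : ∅ ∪ C ⊆ C
    ∅∪C⊆C (inj₂ c) = c

  nonloop-contract⇒∉cl : C ⊆ E → Nonloop (contract sys C) e → ¬ cl sys C e
  nonloop-contract⇒∉cl C⊆E ((_ , e∉C) , ¬loop) e∈clC =
    ¬loop (cl⇒cl-contract (λ ()) C⊆E e∉C (cl-mono inj₂ e∈clC))

  cl-contract-｛｝-⊆ : C ⊆ E → f ∈ E → cl sys (C + f) e →
                      cl (contract sys C) ｛ e ｝ ⊆ cl (contract sys C) ｛ f ｝
  cl-contract-｛｝-⊆ {C = C} {f = f} {e = e} C⊆E f∈E e∈cl y∈cl@((_ , y∉C) , _) =
    cl⇒cl-contract (λ { refl → f∈E }) C⊆E y∉C (cl-⊆-cl f∪C⊆E e∪C⊆cl (cl-contract⇒cl y∈cl))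
    where
    f∪C⊆E : ｛ f ｝ ∪ C ⊆ E
    f∪C⊆E (inj₁ refl) = f∈E
    f∪C⊆E (inj₂ c) = C⊆E c

    e∪C⊆cl : ｛ e ｝ ∪ C ⊆ cl sys (｛ f ｝ ∪ C)
    e∪C⊆cl (inj₁ refl) = cl-mono (λ { (inj₁ c) → inj₂ c ; (inj₂ refl) → inj₁ refl }) e∈cl
    e∪C⊆cl (inj₂ c) = ⊆-cl f∪C⊆E (inj₂ c)

  parallel-contract : C ⊆ E → e ∈ E → ¬ cl sys C e → cl sys (C + e) f → ¬ cl sys C f →
                      Parallel (contract sys C) e f
  parallel-contract C⊆E e∈E e∉clC f∈cl f∉clC =
    nonloop-contract C⊆E e∈E e∉clC , nonloop-contract C⊆E (cl-⊆E f∈cl) f∉clC ,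
    cl-contract-｛｝-⊆ C⊆E (cl-⊆E f∈cl) (exchange C⊆E e∈E f∈cl f∉clC) ,
    cl-contract-｛｝-⊆ C⊆E e∈E f∈cl

  parallel-contract⇒cl : Parallel (contract sys C) e f → cl sys (C + e) f
  parallel-contract⇒cl (_ , (f∈E∖C , _) , _ , clf⊆cle) =
    cl-mono (λ { (inj₁ refl) → inj₂ refl ; (inj₂ c) → inj₁ c })
            (cl-contract⇒cl (clf⊆cle (f∈E∖C , inj₁ refl)))

  contractLoops-loops : Z ⊆ E → Z ⊆ cl (contractLoops sys Z) ∅
  contractLoops-loops {Z = Z} Z⊆E z∈Z with basis-exists {X = Z ∩ E} proj₂
  ... | J , bJ@(_ , iJ , _) =
    Z⊆E z∈Z , inj₂ (∅ , (λ ()) , ((λ ()) , J , bJ , indep-⊆ iJ ∅∪J⊆J) ,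
                    λ (∅+z⊆E∖Z , _) → proj₂ (∅+z⊆E∖Z (inj₂ refl)) z∈Z)
    where
    ∅∪J⊆J : ∅ ∪ J ⊆ J
    ∅∪J⊆J (inj₂ j) = j

  -- An independent set of M / Z avoids Z, so only X ∖ Z matters for its bases in X.
  contract-basis-∖ : Indep/ Z B → X ∩ Y ⊆ Z →
                     Basis (contract sys Z) X (B ∩ X) ⇔ Basis (contract sys Z) (X ∖ Y) (B ∩ (X ∖ Y))
  contract-basis-∖ {Z = Z} {B = B} {X = X} {Y = Y} iB X∩Y⊆Z = mk⇔ to from
    where
    avoids-Y : ∀ {K} → Indep/ Z K → K ∩ X ⊆ X ∖ Y
    avoids-Y (K⊆E∖Z , _) (k , x) = x , λ y → proj₂ (K⊆E∖Z k) (X∩Y⊆Z (x , y))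

    to : Basis (contract sys Z) X (B ∩ X) → Basis (contract sys Z) (X ∖ Y) (B ∩ (X ∖ Y))
    to (_ , _ , maximal) = proj₂ , contract-indep-⊆ iB proj₁ , λ K iK B∩X∖Y⊆K K⊆X∖Y k∈K →
      proj₁ (maximal K iK (λ (b , x) → B∩X∖Y⊆K (b , avoids-Y iB (b , x))) (λ k → proj₁ (K⊆X∖Y k)) k∈K) ,
      K⊆X∖Y k∈K

    from : Basis (contract sys Z) (X ∖ Y) (B ∩ (X ∖ Y)) → Basis (contract sys Z) X (B ∩ X)
    from (_ , _ , maximal) = proj₂ , contract-indep-⊆ iB proj₁ , λ K iK B∩X⊆K K⊆X k∈K →
      proj₁ (maximal K iK (λ (b , x , _) → B∩X⊆K (b , x)) (λ k → avoids-Y iK (k , K⊆X k)) k∈K) , K⊆X k∈K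

  -- Every element of J lies in K (if in Z) or in B ∩ X ⊆ L (if not), so J ⊆ L ∪ K and the
  -- maximality of J applies.
  contract-basis-of-basis : Z ⊆ X → Basis sys (Z ∩ E) K → K ⊆ J → Basis sys X J → Indep/ Z B → J ∖ Z ⊆ B →
                            Basis (contract sys Z) X (B ∩ X)
  contract-basis-of-basis {Z = Z} {X = X} {K = K} {J = J} {B = B}
                          Z⊆X bK@(K⊆Z∩E , _) K⊆J (J⊆X , iJ , maximalJ) iB J∖Z⊆B =
    proj₂ , contract-indep-⊆ iB proj₁ , maximal
    where
    maximal : ∀ L → Indep/ Z L → B ∩ X ⊆ L → L ⊆ X → L ⊆ B ∩ X
    maximal L iL@(L⊆E∖Z , _) B∩X⊆L L⊆X l∈L = J∖Z⊆B (l∈J , proj₂ (L⊆E∖Z l∈L)) , L⊆X l∈L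
      where
      J⊆L∪K : J ⊆ L ∪ K
      J⊆L∪K {x} x∈J with dec (x ∈ Z)
      ... | yes x∈Z = inj₂ (basis-maximal bK (x∈Z , indep-⊆E J iJ x∈J) (indep-⊆ iJ (+-⊆ K⊆J x∈J)))
      ... | no x∉Z = inj₁ (B∩X⊆L (J∖Z⊆B (x∈J , x∉Z) , J⊆X x∈J))

      L∪K⊆X : L ∪ K ⊆ X
      L∪K⊆X (inj₁ l) = L⊆X l
      L∪K⊆X (inj₂ k) = Z⊆X (proj₁ (K⊆Z∩E k))

      l∈J : _ ∈ J
      l∈J = maximalJ (L ∪ K) (contract-indep-swap iL bK) J⊆L∪K L∪K⊆X (inj₁ l∈L)

  contract-basis⇒⊆cl : X ⊆ E → Basis sys (Z ∩ E) J → Basis (contract sys Z) X I → X ⊆ cl sys (I ∪ J)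
  contract-basis⇒⊆cl {Z = Z} {J = J} {I = I} X⊆E bJ (I⊆X , iI@(I⊆E∖Z , _) , maximal) {x} x∈X
    with dec (x ∈ Z)
  ... | yes x∈Z = cl-mono {Y = I ∪ J} inj₂ (basis⇒⊆cl proj₂ bJ (x∈Z , X⊆E x∈X))
  ... | no x∉Z = by-contradiction λ x∉cl → x∉cl (⊆-cl I∪J⊆E (inj₁ (x∈I x∉cl)))
    where
    iI∪J : Indep (I ∪ J)
    iI∪J = contract-indep-swap iI bJ

    I∪J⊆E : I ∪ J ⊆ E
    I∪J⊆E = indep-⊆E _ iI∪J

    x∈I : ¬ cl sys (I ∪ J) x → x ∈ I
    x∈I x∉cl = maximal (I + x) contract-indep-I+x inj₁ (+-⊆ I⊆X x∈X) (inj₂ refl)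
      where
      I+x⊆E∖Z : I + x ⊆ E ∖ Z
      I+x⊆E∖Z (inj₁ i) = I⊆E∖Z i
      I+x⊆E∖Z (inj₂ refl) = X⊆E x∈X , x∉Z

      contract-indep-I+x : Indep/ Z (I + x)
      contract-indep-I+x = I+x⊆E∖Z , _ , bJ , indep-⊆ (∉cl⇒indep iI∪J (X⊆E x∈X) x∉cl) (+-∪-⊆ {A = I} {B = J})

module Conditions (em : ExcludedMiddle) {α : Set} (M : Matroid α) (F : Subset α) (flat-F : Flat (Matroid.sys M) F) where
  open Classical em
  open Matroid M
  open MatroidTheory em M

  private variable
    G : Subset α

  F⊆E : F ⊆ E
  F⊆E = proj₁ flat-F

  1⇒4 : Cond1 M F → Cond4 M F
  1⇒4 (_ , modular) G flat-G F∩G⊆loops = modular G flat-G , F∩G⊆loops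

  4⇒5 : Cond4 M F → Cond5 M F
  4⇒5 cond4 F' (_ , flat-F' , _ , F∩F'⊆loops , _) = cond4 F' flat-F' F∩F'⊆loops

  -- With J_Z ⊆ J_G bases of F ∩ G ⊆ G, the flat spanned by J_G ∖ J_Z meets F only in loops, and
  -- skewness of F to it makes J_F ∪ J_G independent.
  4⇒1 : Cond4 M F → Cond1 M F
  4⇒1 cond4 = flat-F , modular-with
    where
    modular-with : ∀ G → Flat sys G → ModularPair sys F G
    modular-with G flat-G@(G⊆E , _) with basis-exists {X = F ∩ G} (λ (f , _) → F⊆E f)
    ... | JZ , bZ@(JZ⊆F∩G , iZ , _)
      with basis-extend G⊆E iZ (λ z → proj₂ (JZ⊆F∩G z)) | basis-extend F⊆E iZ (λ z → proj₁ (JZ⊆F∩G z))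
    ... | JG , JZ⊆JG , bG@(JG⊆G , iG , _) | JF , JZ⊆JF , bF@(JF⊆F , iF , _) =
      modularPair-of-bases F⊆E G⊆E bF bG (indep-⊆ iJF∪K JF∪JG⊆JF∪K)
      where
      K⊆E : JG ∖ JZ ⊆ E
      K⊆E (j , _) = G⊆E (JG⊆G j)

      F∩⟨K⟩⊆loops : F ∩ ⟨ JG ∖ JZ ⟩ ⊆ cl sys ∅
      F∩⟨K⟩⊆loops {x} (x∈F , x∈⟨K⟩) = cl-mono JZ∩K⊆∅ (cl-∩ iG JZ⊆JG K⊆JG (x∈clJZ , x∈clK))
        where
        JZ∩K⊆∅ : JZ ∩ (JG ∖ JZ) ⊆ ∅
        JZ∩K⊆∅ (z , _ , z∉JZ) = z∉JZ z

        K⊆JG : JG ∖ JZ ⊆ JG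
        K⊆JG = proj₁

        x∈clK : cl sys (JG ∖ JZ) x
        x∈clK = ⟨⟩⁻ x∈⟨K⟩

        x∈clJZ : cl sys JZ x
        x∈clJZ = basis⇒⊆cl (λ (f , _) → F⊆E f) bZ (x∈F , flat-cl flat-G (⊆-trans {j = JG} K⊆JG JG⊆G) x∈clK)

      iJF∪K : Indep (JF ∪ (JG ∖ JZ))
      iJF∪K = skew⇒indep-∪ F⊆E (proj₁ (⟨⟩-flat K⊆E))
                           (cond4 ⟨ JG ∖ JZ ⟩ (⟨⟩-flat K⊆E) F∩⟨K⟩⊆loops)
                           iF JF⊆F (indep-⊆ iG proj₁) (λ k → ⟨⟩⁺ (⊆-cl K⊆E k))

      JF∪JG⊆JF∪K : JF ∪ JG ⊆ JF ∪ (JG ∖ JZ)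
      JF∪JG⊆JF∪K (inj₁ f) = inj₁ f
      JF∪JG⊆JF∪K {x} (inj₂ x∈JG) with dec (x ∈ JZ)
      ... | yes x∈JZ = inj₁ (JZ⊆JF x∈JZ)
      ... | no x∉JZ = inj₂ (x∈JG , x∉JZ)

  -- Extend a basis J_G of G to a basis L of F ∪ G and then to a base B; the flat spanned by
  -- J_G ∪ (B ∖ L) is a complement of F containing G.
  complement-containing : Flat sys G → F ∩ G ⊆ cl sys ∅ → ∃[ F' ] (Complementary sys F F' × G ⊆ F')
  complement-containing {G = G} flat-G@(G⊆E , _) F∩G⊆loops with basis-exists G⊆E
  ... | JG , bG@(JG⊆G , iG , _) with basis-extend {X = F ∪ G} [ F⊆E , G⊆E ]′ iG (λ j → inj₂ (JG⊆G j))
  ... | L , JG⊆L , bL@(_ , iL , _) with basis-extend {X = E} id iL (indep-⊆E L iL)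
  ... | B , L⊆B , bB@(_ , iB , _) =
    ⟨ S ⟩ ,
    (flat-F , flat-⟨S⟩ , (F∪⟨S⟩⊆E , E⊆cl) , (F∩⟨S⟩⊆loops , λ x → loops⊆flat flat-F x , loops⊆flat flat-⟨S⟩ x)) ,
    G⊆⟨S⟩
    where
    S : Subset α
    S = JG ∪ (B ∖ L)

    S⊆B : S ⊆ B
    S⊆B (inj₁ j) = L⊆B (JG⊆L j)
    S⊆B (inj₂ (b , _)) = b

    S⊆E : S ⊆ E
    S⊆E = ⊆-trans {j = B} S⊆B (indep-⊆E B iB)

    flat-⟨S⟩ : Flat sys ⟨ S ⟩
    flat-⟨S⟩ = ⟨⟩-flat S⊆E

    F∪⟨S⟩⊆E : F ∪ ⟨ S ⟩ ⊆ E
    F∪⟨S⟩⊆E = [ F⊆E , proj₁ flat-⟨S⟩ ]′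

    G⊆⟨S⟩ : G ⊆ ⟨ S ⟩
    G⊆⟨S⟩ g = ⟨⟩⁺ (cl-mono {Y = S} inj₁ (basis⇒⊆cl G⊆E bG g))

    B⊆F∪⟨S⟩ : B ⊆ F ∪ ⟨ S ⟩
    B⊆F∪⟨S⟩ {b} b∈B with dec (b ∈ L)
    ... | no b∉L = inj₂ (⟨⟩⁺ (⊆-cl S⊆E (inj₂ (b∈B , b∉L))))
    ... | yes b∈L with proj₁ bL b∈L
    ...   | inj₁ b∈F = inj₁ b∈F
    ...   | inj₂ b∈G = inj₂ (G⊆⟨S⟩ b∈G)

    E⊆cl : E ⊆ cl sys (F ∪ ⟨ S ⟩)
    E⊆cl x = cl-mono B⊆F∪⟨S⟩ (basis⇒⊆cl id bB x)

    L∩S⊆JG : L ∩ S ⊆ JG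
    L∩S⊆JG (_ , inj₁ j) = j
    L∩S⊆JG (l , inj₂ (_ , l∉L)) = ⊥-elim (l∉L l)

    F∩⟨S⟩⊆loops : F ∩ ⟨ S ⟩ ⊆ cl sys ∅
    F∩⟨S⟩⊆loops {x} (x∈F , x∈⟨S⟩) = F∩G⊆loops (x∈F , flat-cl flat-G JG⊆G (cl-mono L∩S⊆JG x∈cl))
      where
      x∈cl : cl sys (L ∩ S) x
      x∈cl = cl-∩ iB L⊆B S⊆B (basis⇒⊆cl [ F⊆E , G⊆E ]′ bL (inj₁ x∈F) , ⟨⟩⁻ x∈⟨S⟩)

  BasesIndep : Set₁
  BasesIndep = ∀ {G JF JG} → Flat sys G → F ∩ G ⊆ cl sys ∅ → Basis sys F JF → Basis sys G JG → Indep (JF ∪ JG)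

  skew-if-bases-indep : BasesIndep → Cond4 M F
  skew-if-bases-indep indep-bases G flat-G@(G⊆E , _) F∩G⊆loops with basis-exists F⊆E | basis-exists G⊆E
  ... | JF , bF | JG , bG = modularPair-of-bases F⊆E G⊆E bF bG (indep-bases flat-G F∩G⊆loops bF bG) , F∩G⊆loops

  5⇒4 : Cond5 M F → Cond4 M F
  5⇒4 cond5 = skew-if-bases-indep λ flat-G F∩G⊆loops (JF⊆F , iF , _) (JG⊆G , iG , _) →
    let F' , complementary@(_ , (F'⊆E , _) , _) , G⊆F' = complement-containing flat-G F∩G⊆loops
    in skew⇒indep-∪ F⊆E F'⊆E (cond5 F' complementary) iF JF⊆F iG (λ j → G⊆F' (JG⊆G j))

  -- Choose bases J_Z ⊆ J_H ⊆ J_F of F ∩ G ⊆ H = (F ∩ G) ∪ F₀ ⊆ F and J_Z ⊆ J_G of G; modularity makes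
  -- J_F ∪ J_G independent, and x ∈ cl(J_H ∪ J_G) ∩ cl J_F ⊆ cl((J_H ∪ J_G) ∩ J_F) = cl J_H.
  1⇒7 : Cond1 M F → Cond7 M F
  1⇒7 (_ , modular) F₀ G _ flat-G@(G⊆E , _) F₀⊆F = F∩cl⊆clH , clH⊆F∩cl
    where
    H : Subset α
    H = (F ∩ G) ∪ F₀

    H⊆F : H ⊆ F
    H⊆F (inj₁ (f , _)) = f
    H⊆F (inj₂ f₀) = F₀⊆F f₀

    H⊆E : H ⊆ E
    H⊆E y = F⊆E (H⊆F y)

    H⊆G∪F₀ : H ⊆ G ∪ F₀
    H⊆G∪F₀ (inj₁ (_ , g)) = inj₁ g
    H⊆G∪F₀ (inj₂ f₀) = inj₂ f₀

    clH⊆F∩cl : cl sys H ⊆ F ∩ cl sys (G ∪ F₀)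
    clH⊆F∩cl c = flat-cl flat-F H⊆F c , cl-mono H⊆G∪F₀ c

    F∩cl⊆clH : F ∩ cl sys (G ∪ F₀) ⊆ cl sys H
    F∩cl⊆clH {x} (x∈F , x∈cl) with basis-exists {X = F ∩ G} (λ (f , _) → F⊆E f)
    ... | JZ , bZ@(JZ⊆F∩G , iZ , _)
      with basis-extend H⊆E iZ (λ z → inj₁ (JZ⊆F∩G z)) | basis-extend G⊆E iZ (λ z → proj₂ (JZ⊆F∩G z))
    ... | JH , JZ⊆JH , bH@(JH⊆H , iH , _) | JG , JZ⊆JG , bG@(JG⊆G , _)
      with basis-extend F⊆E iH (⊆-trans {j = H} JH⊆H H⊆F)
    ... | JF , JH⊆JF , bF@(JF⊆F , iF , _) =
      cl-mono JH⊆H (cl-mono JH∪JG∩JF⊆JH (cl-∩ iJF∪JG JH∪JG⊆JF∪JG inj₁ (x∈clJH∪JG , x∈clJF)))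
      where
      iJF∪JG : Indep (JF ∪ JG)
      iJF∪JG = modularPair⇒indep-∪ F⊆E G⊆E (modular G flat-G) bZ bF (⊆-trans {j = JH} JZ⊆JH JH⊆JF) bG JZ⊆JG

      JH∪JG⊆JF∪JG : JH ∪ JG ⊆ JF ∪ JG
      JH∪JG⊆JF∪JG (inj₁ y) = inj₁ (JH⊆JF y)
      JH∪JG⊆JF∪JG (inj₂ g) = inj₂ g

      JH∪JG∩JF⊆JH : (JH ∪ JG) ∩ JF ⊆ JH
      JH∪JG∩JF⊆JH (inj₁ y , _) = y
      JH∪JG∩JF⊆JH (inj₂ g , f) =
        JZ⊆JH (basis-maximal bZ (JF⊆F f , JG⊆G g) (indep-⊆ iF (+-⊆ (⊆-trans {j = JH} JZ⊆JH JH⊆JF) f)))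

      JH∪JG⊆E : JH ∪ JG ⊆ E
      JH∪JG⊆E = indep-⊆E _ (indep-⊆ iJF∪JG JH∪JG⊆JF∪JG)

      G∪F₀⊆cl : G ∪ F₀ ⊆ cl sys (JH ∪ JG)
      G∪F₀⊆cl (inj₁ g) = cl-mono {Y = JH ∪ JG} inj₂ (basis⇒⊆cl G⊆E bG g)
      G∪F₀⊆cl (inj₂ f₀) = cl-mono {Y = JH ∪ JG} inj₁ (basis⇒⊆cl H⊆E bH (inj₂ f₀))

      x∈clJH∪JG : cl sys (JH ∪ JG) x
      x∈clJH∪JG = cl-⊆-cl JH∪JG⊆E G∪F₀⊆cl x∈cl

      x∈clJF : cl sys JF x
      x∈clJF = basis⇒⊆cl F⊆E bF x∈F

  -- If J_F ∪ J_G were dependent, some x ∈ J_F would lie in cl(J_G ∪ C) with C ⊆ J_F ∖ {x};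
  -- condition (7) with F₀ = cl C then puts x in cl C.
  7⇒4 : Cond7 M F → Cond4 M F
  7⇒4 cond7 = skew-if-bases-indep indep-bases
    where
    indep-bases : BasesIndep
    indep-bases {G} {JF} {JG} flat-G@(G⊆E , _) F∩G⊆loops (JF⊆F , iF , _) (JG⊆G , iG , _) =
      by-contradiction λ dep → absurd (dependent-∪ JG∪JF⊆E iG λ i → dep (indep-⊆ i JF∪JG⊆JG∪JF))
      where
      JG∪JF⊆E : JG ∪ JF ⊆ E
      JG∪JF⊆E (inj₁ g) = G⊆E (JG⊆G g)
      JG∪JF⊆E (inj₂ f) = F⊆E (JF⊆F f)

      JF∪JG⊆JG∪JF : JF ∪ JG ⊆ JG ∪ JF
      JF∪JG⊆JG∪JF = [ inj₂ , inj₁ ]′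

      absurd : ¬ (∃[ x ] ∃[ C ] (x ∈ JF × C ⊆ JF × x ∉ C × cl sys (JG ∪ C) x))
      absurd (x , C , x∈JF , C⊆JF , x∉C , x∈cl) =
        indep⇒∉cl (indep-⊆ iF (+-⊆ C⊆JF x∈JF)) x∉C (cl-⊆-cl C⊆E F∩G∪⟨C⟩⊆clC x∈cl′)
        where
        C⊆E : C ⊆ E
        C⊆E c = F⊆E (JF⊆F (C⊆JF c))

        ⟨C⟩⊆F : ⟨ C ⟩ ⊆ F
        ⟨C⟩⊆F c = flat-cl flat-F (⊆-trans {j = JF} C⊆JF JF⊆F) (⟨⟩⁻ c)

        JG∪C⊆G∪⟨C⟩ : JG ∪ C ⊆ G ∪ ⟨ C ⟩
        JG∪C⊆G∪⟨C⟩ (inj₁ g) = inj₁ (JG⊆G g)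
        JG∪C⊆G∪⟨C⟩ (inj₂ c) = inj₂ (⟨⟩⁺ (⊆-cl C⊆E c))

        F∩G∪⟨C⟩⊆clC : (F ∩ G) ∪ ⟨ C ⟩ ⊆ cl sys C
        F∩G∪⟨C⟩⊆clC (inj₁ f∈F∩G) = cl-mono (λ ()) (F∩G⊆loops f∈F∩G)
        F∩G∪⟨C⟩⊆clC (inj₂ c) = ⟨⟩⁻ c

        x∈cl′ : cl sys ((F ∩ G) ∪ ⟨ C ⟩) x
        x∈cl′ = proj₁ (cond7 ⟨ C ⟩ G (⟨⟩-flat C⊆E) flat-G ⟨C⟩⊆F)
                      (JF⊆F x∈JF , cl-mono JG∪C⊆G∪⟨C⟩ x∈cl)

  1⇒3 : Cond1 M F → Cond3 M F
  1⇒3 (_ , modular) G flat-G@(G⊆E , _) with basis-exists {X = (F ∩ G) ∩ E} proj₂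
  ... | JZ , bZ@(JZ⊆Z∩E , iZ , _)
    with basis-extend F⊆E iZ (λ z → proj₁ (proj₁ (JZ⊆Z∩E z)))
       | basis-extend G⊆E iZ (λ z → proj₂ (proj₁ (JZ⊆Z∩E z)))
  ... | JF , JZ⊆JF , bF | JG , JZ⊆JG , bG =
    (D , iD , contract-basis-of-basis proj₁ bZ JZ⊆JF bF iD (λ (f , f∉Z) → inj₁ f , f∉Z)
            , contract-basis-of-basis proj₂ bZ JZ⊆JG bG iD (λ (g , g∉Z) → inj₂ g , g∉Z)) ,
    contractLoops-loops (λ (f , _) → F⊆E f)
    where
    iJF∪JG : Indep (JF ∪ JG)
    iJF∪JG = modularPair⇒indep-∪ F⊆E G⊆E (modular G flat-G) (basis-cong (proj₁ , λ z → z , F⊆E (proj₁ z)) bZ)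
                                  bF JZ⊆JF bG JZ⊆JG

    D : Subset α
    D = (JF ∪ JG) ∖ (F ∩ G)

    D∪JZ⊆JF∪JG : D ∪ JZ ⊆ JF ∪ JG
    D∪JZ⊆JF∪JG (inj₁ (j , _)) = j
    D∪JZ⊆JF∪JG (inj₂ z) = inj₁ (JZ⊆JF z)

    iD : Indep/ (F ∩ G) D
    iD = (λ (j , j∉Z) → indep-⊆E _ iJF∪JG j , j∉Z) , JZ , bZ , indep-⊆ iJF∪JG D∪JZ⊆JF∪JG

  -- If B is independent in M / Z with Z = F ∩ G, and J is the basis of Z it is independent
  -- with, then (B ∩ F) ∪ J and (B ∩ G) ∪ J span F and G inside the independent B ∪ J.
  3⇒1 : Cond3 M F → Cond1 M F
  3⇒1 cond3 = flat-F , modular-with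
    where
    modular-with : ∀ G → Flat sys G → ModularPair sys F G
    modular-with G flat-G@(G⊆E , _) with cond3 G flat-G
    ... | (B , (_ , J , bJ@(J⊆Z∩E , _) , iB∪J) , bF , bG) , _ =
      modularPair-intro (indep-⊆ iB∪J union⊆B∪J) [ proj₂ , (λ j → proj₁ (proj₁ (J⊆Z∩E j))) ]′
                        [ proj₂ , (λ j → proj₂ (proj₁ (J⊆Z∩E j))) ]′
                        (contract-basis⇒⊆cl F⊆E bJ bF) (contract-basis⇒⊆cl G⊆E bJ bG)
      where
      union⊆B∪J : ((B ∩ F) ∪ J) ∪ ((B ∩ G) ∪ J) ⊆ B ∪ J
      union⊆B∪J (inj₁ (inj₁ (b , _))) = inj₁ b
      union⊆B∪J (inj₁ (inj₂ j)) = inj₂ j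
      union⊆B∪J (inj₂ (inj₁ (b , _))) = inj₁ b
      union⊆B∪J (inj₂ (inj₂ j)) = inj₂ j

  3⇒2 : Cond3 M F → Cond2 M F
  3⇒2 cond3 G flat-G with cond3 G flat-G
  ... | (B , iB , bF , bG) , _ =
    (B , iB , Equivalence.to (contract-basis-∖ iB id) bF ,
              Equivalence.to (contract-basis-∖ iB (λ (g , f) → f , g)) bG) ,
    λ ((_ , x∉G) , (x∈G , _)) → ⊥-elim (x∉G x∈G)

  2⇒3 : Cond2 M F → Cond3 M F
  2⇒3 cond2 G flat-G with cond2 G flat-G
  ... | (B , iB , bF , bG) , _ =
    (B , iB , Equivalence.from (contract-basis-∖ iB id) bF ,
              Equivalence.from (contract-basis-∖ iB (λ (g , f) → f , g)) bG) ,
    contractLoops-loops (λ (f , _) → F⊆E f)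

  F-witness : Subset α → α → Set₁
  F-witness C x = ∃[ f ] (f ∈ F × cl sys (C + x) f × ¬ cl sys C f)

  -- Condition (6) with the contraction unfolded.
  Cond6′ : Set₁
  Cond6′ = ∀ C x → C ⊆ E → ¬ cl sys C x → cl sys (F ∪ C) x → F-witness C x

  6⇒6′ : Cond6 M F → Cond6′
  6⇒6′ cond6 C x C⊆E x∉clC x∈cl =
    let f , f∈F , parallel = cond6 C C⊆E x (nonloop-contract C⊆E (cl-⊆E x∈cl) x∉clC)
                             (cl⇒cl-contract F∖C⊆E C⊆E (λ x∈C → x∉clC (⊆-cl C⊆E x∈C)) (cl-mono F∪C⊆F∖C∪C x∈cl))
    in f , f∈F , parallel-contract⇒cl parallel , nonloop-contract⇒∉cl C⊆E (proj₁ (proj₂ parallel))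
    where
    F∖C⊆E : F ∖ C ⊆ E
    F∖C⊆E (f , _) = F⊆E f

    F∪C⊆F∖C∪C : F ∪ C ⊆ (F ∖ C) ∪ C
    F∪C⊆F∖C∪C (inj₂ c) = inj₂ c
    F∪C⊆F∖C∪C {y} (inj₁ y∈F) with dec (y ∈ C)
    ... | yes y∈C = inj₂ y∈C
    ... | no y∉C = inj₁ (y∈F , y∉C)

  6′⇒6 : Cond6′ → Cond6 M F
  6′⇒6 cond6′ C C⊆E e nonloop-e@((e∈E , _) , _) e∈cl =
    let f , f∈F , f∈cl , f∉clC = cond6′ C e C⊆E e∉clC (cl-mono F∖C∪C⊆F∪C (cl-contract⇒cl e∈cl))
    in f , f∈F , parallel-contract C⊆E e∈E e∉clC f∈cl f∉clC
    where
    e∉clC : ¬ cl sys C e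
    e∉clC = nonloop-contract⇒∉cl C⊆E nonloop-e

    F∖C∪C⊆F∪C : (F ∖ C) ∪ C ⊆ F ∪ C
    F∖C∪C⊆F∪C (inj₁ (f , _)) = inj₁ f
    F∖C∪C⊆F∪C (inj₂ c) = inj₂ c

  witness-outside-cl : ∀ {C x} → ¬ (F ∩ cl sys (C + x) ⊆ cl sys C) → F-witness C x
  witness-outside-cl not-all = by-contradiction λ none →
    not-all λ (f∈F , f∈cl) → by-contradiction λ f∉clC → none (_ , f∈F , f∈cl , f∉clC)

  -- Suppose F ∩ cl(C + e) ⊆ cl C.  Bases J_Z ⊆ J_H of F ∩ cl(C + e) ⊆ cl C make J_H + e a basis
  -- of cl(C + e), and modularity makes J_F ∪ (J_H + e) independent although e ∈ cl(J_F ∪ J_H).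
  1⇒6′ : Cond1 M F → Cond6′
  1⇒6′ (_ , modular) C e C⊆E e∉clC e∈cl = witness-outside-cl absurd
    where
    e∈E : e ∈ E
    e∈E = cl-⊆E e∈cl

    C+e⊆E : C + e ⊆ E
    C+e⊆E = +-⊆ C⊆E e∈E

    ⟨C⟩⊆⟨C+e⟩ : ⟨ C ⟩ ⊆ ⟨ C + e ⟩
    ⟨C⟩⊆⟨C+e⟩ c = ⟨⟩⁺ (cl-mono {Y = C + e} inj₁ (⟨⟩⁻ c))

    absurd : ¬ (F ∩ cl sys (C + e) ⊆ cl sys C)
    absurd F∩cl⊆clC with basis-exists {X = F ∩ ⟨ C + e ⟩} (λ (f , _) → F⊆E f)
    ... | JZ , bZ@(JZ⊆F∩G , iZ , _)
      with basis-extend (proj₁ (⟨⟩-flat C⊆E)) iZ (λ z → ⟨⟩⁺ (F∩cl⊆clC (map₂ ⟨⟩⁻ (JZ⊆F∩G z))))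
         | basis-extend F⊆E iZ (λ z → proj₁ (JZ⊆F∩G z))
    ... | JH , JZ⊆JH , bH@(JH⊆⟨C⟩ , iH , _) | JF , JZ⊆JF , bF@(JF⊆F , _) =
      indep⇒∉cl (indep-⊆ iJF∪JH+e JF∪JH+e⊆) e∉JF∪JH (cl-⊆-cl JF∪JH⊆E F∪C⊆cl e∈cl)
      where
      JH⊆clC : JH ⊆ cl sys C
      JH⊆clC j = ⟨⟩⁻ (JH⊆⟨C⟩ j)

      C⊆clJH : C ⊆ cl sys JH
      C⊆clJH c = basis⇒⊆cl (proj₁ (⟨⟩-flat C⊆E)) bH (⟨⟩⁺ (⊆-cl C⊆E c))

      bH+e : Basis sys ⟨ C + e ⟩ (JH + e)
      bH+e = basis-intro (+-⊆ (λ j → ⟨C⟩⊆⟨C+e⟩ (JH⊆⟨C⟩ j)) (⟨⟩⁺ (⊆-cl C+e⊆E (inj₂ refl))))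
                         (∉cl⇒indep iH e∈E (λ c → e∉clC (cl-⊆-cl C⊆E JH⊆clC c)))
                         (λ x → cl-⊆-cl JH+e⊆E C+e⊆cl (⟨⟩⁻ x))
        where
        JH+e⊆E : JH + e ⊆ E
        JH+e⊆E = +-⊆ (indep-⊆E JH iH) e∈E

        C+e⊆cl : C + e ⊆ cl sys (JH + e)
        C+e⊆cl (inj₁ c) = cl-mono {Y = JH + e} inj₁ (C⊆clJH c)
        C+e⊆cl (inj₂ refl) = ⊆-cl JH+e⊆E (inj₂ refl)

      iJF∪JH+e : Indep (JF ∪ (JH + e))
      iJF∪JH+e = modularPair⇒indep-∪ F⊆E (proj₁ (⟨⟩-flat C+e⊆E)) (modular ⟨ C + e ⟩ (⟨⟩-flat C+e⊆E))
                                      bZ bF JZ⊆JF bH+e (λ z → inj₁ (JZ⊆JH z))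

      JF∪JH+e⊆ : (JF ∪ JH) + e ⊆ JF ∪ (JH + e)
      JF∪JH+e⊆ (inj₁ (inj₁ f)) = inj₁ f
      JF∪JH+e⊆ (inj₁ (inj₂ h)) = inj₂ (inj₁ h)
      JF∪JH+e⊆ (inj₂ refl) = inj₂ (inj₂ refl)

      JF∪JH⊆E : JF ∪ JH ⊆ E
      JF∪JH⊆E = indep-⊆E _ (indep-⊆ iJF∪JH+e (λ j → JF∪JH+e⊆ (inj₁ j)))

      F∪C⊆cl : F ∪ C ⊆ cl sys (JF ∪ JH)
      F∪C⊆cl (inj₁ f) = cl-mono {Y = JF ∪ JH} inj₁ (basis⇒⊆cl F⊆E bF f)
      F∪C⊆cl (inj₂ c) = cl-mono {Y = JF ∪ JH} inj₂ (C⊆clJH c)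

      e∉JF∪JH : e ∉ JF ∪ JH
      e∉JF∪JH (inj₁ e∈JF) = e∉clC (F∩cl⊆clC (JF⊆F e∈JF , ⊆-cl C+e⊆E (inj₂ refl)))
      e∉JF∪JH (inj₂ e∈JH) = e∉clC (JH⊆clC e∈JH)

  8⇒6′ : Cond8 M F → Cond6′
  8⇒6′ cond8 C e C⊆E e∉clC e∈cl = witness-outside-cl λ F∩cl⊆clC →
    e∉clC (cl-⊆-cl C⊆E (⟨C⟩∪F∩⟨C+e⟩⊆clC F∩cl⊆clC) e∈cl′)
    where
    C+e⊆E : C + e ⊆ E
    C+e⊆E = +-⊆ C⊆E (cl-⊆E e∈cl)

    ⟨C⟩⊆⟨C+e⟩ : ⟨ C ⟩ ⊆ ⟨ C + e ⟩
    ⟨C⟩⊆⟨C+e⟩ c = ⟨⟩⁺ (cl-mono {Y = C + e} inj₁ (⟨⟩⁻ c))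

    F∪C⊆⟨C⟩∪F : F ∪ C ⊆ ⟨ C ⟩ ∪ F
    F∪C⊆⟨C⟩∪F (inj₁ f) = inj₂ f
    F∪C⊆⟨C⟩∪F (inj₂ c) = inj₁ (⟨⟩⁺ (⊆-cl C⊆E c))

    ⟨C⟩∪F∩⟨C+e⟩⊆clC : F ∩ cl sys (C + e) ⊆ cl sys C → ⟨ C ⟩ ∪ (F ∩ ⟨ C + e ⟩) ⊆ cl sys C
    ⟨C⟩∪F∩⟨C+e⟩⊆clC _ (inj₁ c) = ⟨⟩⁻ c
    ⟨C⟩∪F∩⟨C+e⟩⊆clC F∩cl⊆clC (inj₂ (f , f∈⟨C+e⟩)) = F∩cl⊆clC (f , ⟨⟩⁻ f∈⟨C+e⟩)

    e∈cl′ : cl sys (⟨ C ⟩ ∪ (F ∩ ⟨ C + e ⟩)) e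
    e∈cl′ = proj₁ (cond8 ⟨ C ⟩ ⟨ C + e ⟩ (⟨⟩-flat C⊆E) (⟨⟩-flat C+e⊆E) ⟨C⟩⊆⟨C+e⟩)
                  (cl-mono F∪C⊆⟨C⟩∪F e∈cl , ⟨⟩⁺ (⊆-cl C+e⊆E (inj₂ refl)))

  6′⇒8 : Cond6′ → Cond8 M F
  6′⇒8 cond6′ G₁ G₂ _ flat-G₂@(G₂⊆E , _) G₁⊆G₂ = to , from
    where
    C : Subset α
    C = G₁ ∪ (F ∩ G₂)

    C⊆G₂ : C ⊆ G₂
    C⊆G₂ (inj₁ g) = G₁⊆G₂ g
    C⊆G₂ (inj₂ (_ , g)) = g

    C⊆E : C ⊆ E
    C⊆E c = G₂⊆E (C⊆G₂ c)

    C⊆G₁∪F : C ⊆ G₁ ∪ F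
    C⊆G₁∪F (inj₁ g) = inj₁ g
    C⊆G₁∪F (inj₂ (f , _)) = inj₂ f

    G₁∪F⊆F∪C : G₁ ∪ F ⊆ F ∪ C
    G₁∪F⊆F∪C (inj₁ g) = inj₂ (inj₁ g)
    G₁∪F⊆F∪C (inj₂ f) = inj₁ f

    from : cl sys C ⊆ cl sys (G₁ ∪ F) ∩ G₂
    from c = cl-mono C⊆G₁∪F c , flat-cl flat-G₂ C⊆G₂ c

    to : cl sys (G₁ ∪ F) ∩ G₂ ⊆ cl sys C
    to {x} (x∈cl , x∈G₂) = by-contradiction λ x∉clC →
      let f , f∈F , f∈cl , f∉clC = cond6′ C x C⊆E x∉clC (cl-mono G₁∪F⊆F∪C x∈cl)
      in f∉clC (⊆-cl C⊆E (inj₂ (f∈F , flat-cl flat-G₂ (+-⊆ C⊆G₂ x∈G₂) f∈cl)))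

  -- If J_F ∪ J_G were dependent, some x ∈ J_G would lie in cl(J_F ∪ C) with C ⊆ J_G ∖ {x};
  -- the element of F that (6′) provides then lies in F ∩ G, so it is a loop.
  6′⇒4 : Cond6′ → Cond4 M F
  6′⇒4 cond6′ = skew-if-bases-indep indep-bases
    where
    indep-bases : BasesIndep
    indep-bases {G} {JF} {JG} flat-G F∩G⊆loops (JF⊆F , iF , _) (JG⊆G , iG , _) =
      by-contradiction λ dep → absurd (dependent-∪ JF∪JG⊆E iF dep)
      where
      JF∪JG⊆E : JF ∪ JG ⊆ E
      JF∪JG⊆E (inj₁ f) = F⊆E (JF⊆F f)
      JF∪JG⊆E (inj₂ g) = proj₁ flat-G (JG⊆G g)

      absurd : ¬ (∃[ x ] ∃[ C ] (x ∈ JG × C ⊆ JG × x ∉ C × cl sys (JF ∪ C) x))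
      absurd (x , C , x∈JG , C⊆JG , x∉C , x∈cl) =
        let f , f∈F , f∈cl , f∉clC = cond6′ C x C⊆E x∉clC (cl-mono JF∪C⊆F∪C x∈cl)
        in f∉clC (cl-mono (λ ()) (F∩G⊆loops (f∈F , flat-cl flat-G (+-⊆ C⊆G (JG⊆G x∈JG)) f∈cl)))
        where
        C⊆G : C ⊆ G
        C⊆G c = JG⊆G (C⊆JG c)

        C⊆E : C ⊆ E
        C⊆E c = proj₁ flat-G (C⊆G c)

        x∉clC : ¬ cl sys C x
        x∉clC = indep⇒∉cl (indep-⊆ iG (+-⊆ C⊆JG x∈JG)) x∉C

        JF∪C⊆F∪C : JF ∪ C ⊆ F ∪ C
        JF∪C⊆F∪C (inj₁ f) = inj₁ (JF⊆F f)
        JF∪C⊆F∪C (inj₂ c) = inj₂ c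

mainTheorem16 : ExcludedMiddle → {α : Set} (M : Matroid α) (F : Subset α) →
    Flat (Matroid.sys M) F →
    (Cond1 M F ⇔ Cond2 M F) × (Cond1 M F ⇔ Cond3 M F) × (Cond1 M F ⇔ Cond4 M F) ×
    (Cond1 M F ⇔ Cond5 M F) × (Cond1 M F ⇔ Cond6 M F) × (Cond1 M F ⇔ Cond7 M F) ×
    (Cond1 M F ⇔ Cond8 M F)
mainTheorem16 em M F flat-F =
  mk⇔ (3⇒2 ∘ 1⇒3) (3⇒1 ∘ 2⇒3) ,
  mk⇔ 1⇒3 3⇒1 ,
  mk⇔ 1⇒4 4⇒1 ,
  mk⇔ (4⇒5 ∘ 1⇒4) (4⇒1 ∘ 5⇒4) ,
  mk⇔ (6′⇒6 ∘ 1⇒6′) (4⇒1 ∘ 6′⇒4 ∘ 6⇒6′) ,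
  mk⇔ 1⇒7 (4⇒1 ∘ 7⇒4) ,
  mk⇔ (6′⇒8 ∘ 1⇒6′) (4⇒1 ∘ 6′⇒4 ∘ 8⇒6′)
  where
  open Conditions em M F flat-F
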